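{- The following two statements are equivalent: (i) every set $M$ of $m$ lines drawn in the plane has an EFL coloring with $m$ colors; (ii) every set $M$ of $m$ line segments drawn in the plane has an EFL coloring with $m$ colors.
   Context: For a finite set $M$ of lines (respectively line segments of nonzero length, where collinear intersecting segments are treated as a single segment; likewise coincident lines are one line) in the plane, $P(M)$ denotes the set of intersection points, i.e., points lying on at least two members of $M$. An EFL coloring of $M$ with $k$ colors is a function $f:P(M)\rightarrow \{1,\ldots,k\}$ such that whenever two distinct intersection points $p_1,p_2$ lie on the same member of $M$, $f(p_1)\neq f(p_2)$. -}

module Defs where

open import Level using (0ℓ)
open import Data.Nat using (ℕ)
open import Data.Fin using (Fin)
open import Data.Product using (Σ; ∃; _×_; _,_; proj₁)
open import Data.Sum using (_⊎_)
open import Relation.Nullary using (¬_)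
open import Relation.Binary.PropositionalEquality using (_≡_)
open import Algebra.Structures using (IsCommutativeRing)
open import Relation.Binary.Structures using (IsStrictTotalOrder)

-- The real numbers, axiomatised (up to isomorphism) as a Dedekind-complete
-- ordered field.  Equality is propositional equality on the carrier.
record RealField : Set₁ where
  infixl 6 _+_
  infixl 7 _*_
  infix 4 _<_ _≤_
  field
    R   : Set
    _+_ : R → R → R
    _*_ : R → R → R
    -_  : R → R
    0#  : R
    1#  : R
    _<_ : R → R → Set
    isCommutativeRing   : IsCommutativeRing _≡_ _+_ _*_ -_ 0# 1#
    0≢1                 : ¬ (0# ≡ 1#)
    inverse             : ∀ x → ¬ (x ≡ 0#) → Σ R (λ y → x * y ≡ 1#)
    isStrictTotalOrder  : IsStrictTotalOrder _≡_ _<_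
    +-mono-<            : ∀ {x y} z → x < y → x + z < y + z
    *-pos               : ∀ {x y} → 0# < x → 0# < y → 0# < x * y

  _≤_ : R → R → Set
  x ≤ y = x < y ⊎ x ≡ y

  field
    lub : (S : R → Set) → Σ R S → Σ R (λ u → ∀ x → S x → x ≤ u) →
          Σ R (λ s → (∀ x → S x → x ≤ s) ×
                     (∀ u → (∀ x → S x → x ≤ u) → s ≤ u))

module Plane (ℝ : RealField) where
  open RealField ℝ

  Point : Set
  Point = R × R

  _-ᵖ_ : Point → Point → Point
  (x₁ , y₁) -ᵖ (x₂ , y₂) = (x₁ + (- x₂)) , (y₁ + (- y₂))

  affine : Point → Point → R → Point
  affine (x₁ , y₁) (x₂ , y₂) t =
    (x₁ + t * (x₂ + (- x₁))) , (y₁ + t * (y₂ + (- y₁)))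

  record Line : Set where
    constructor line
    field
      p q  : Point
      p≢q  : ¬ (p ≡ q)

  OnLine : Line → Point → Set
  OnLine (line a b _) x = Σ R (λ t → x ≡ affine a b t)

  SameLine : Line → Line → Set
  SameLine ℓ ℓ′ = ∀ x → (OnLine ℓ x → OnLine ℓ′ x) × (OnLine ℓ′ x → OnLine ℓ x)

  record Segment : Set where
    constructor seg
    field
      a b  : Point
      a≢b  : ¬ (a ≡ b)

  OnSeg : Segment → Point → Set
  OnSeg (seg a b _) x = Σ R (λ t → (0# ≤ t) × (t ≤ 1#) × (x ≡ affine a b t))

  supportLine : Segment → Line
  supportLine (seg a b a≢b) = line a b a≢b

  Collinear : Segment → Segment → Set
  Collinear s s′ = OnLine (supportLine s) (Segment.a s′) ×
                   OnLine (supportLine s) (Segment.b s′)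

  Intersect : Segment → Segment → Set
  Intersect s s′ = Σ Point (λ x → OnSeg s x × OnSeg s′ x)

  LineSet : ℕ → Set
  LineSet m = Σ (Fin m → Line) (λ L → ∀ i j → ¬ (i ≡ j) → ¬ SameLine (L i) (L j))

  -- A set of m segments: no two of them are collinear and intersecting
  -- (such segments would count as a single segment); in particular distinct.
  SegmentSet : ℕ → Set
  SegmentSet m = Σ (Fin m → Segment)
                   (λ S → ∀ i j → ¬ (i ≡ j) → ¬ (Collinear (S i) (S j) × Intersect (S i) (S j)))

  module EFL {A : Set} (On : A → Point → Set) where
    InP : {m : ℕ} → (Fin m → A) → Point → Set
    InP {m} M p = Σ (Fin m) (λ i → Σ (Fin m) (λ j → ¬ (i ≡ j) × On (M i) p × On (M j) p))

    IntPt : {m : ℕ} → (Fin m → A) → Set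
    IntPt M = Σ Point (InP M)

    -- f : P(M) → {1..k}; f is required to depend only on the point.
    IsEFLColoring : {m : ℕ} (M : Fin m → A) (k : ℕ) → (IntPt M → Fin k) → Set
    IsEFLColoring {m} M k f =
      (∀ p (h h′ : InP M p) → f (p , h) ≡ f (p , h′)) ×
      (∀ (x y : IntPt M) (i : Fin m) → ¬ (proj₁ x ≡ proj₁ y) →
         On (M i) (proj₁ x) → On (M i) (proj₁ y) → ¬ (f x ≡ f y))

    HasEFLColoring : {m : ℕ} (M : Fin m → A) (k : ℕ) → Set
    HasEFLColoring M k = Σ (IntPt M → Fin k) (IsEFLColoring M k)

  EFLLines : ℕ → Set
  EFLLines m = (M : LineSet m) → EFL.HasEFLColoring OnLine (proj₁ M) m

  EFLSegments : ℕ → Set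
  EFLSegments m = (M : SegmentSet m) → EFL.HasEFLColoring OnSeg (proj₁ M) m

-- Both implications pull a colouring back along a map between the two families that sends
-- intersection points to intersection points and incidences to incidences.
-- (i) ⇒ (ii): replace each segment by its supporting line. Segments on a common line do not
-- meet, so only the least-indexed one keeps that line; the others get distinct vertical lines
-- to the right of every segment. Two segments through a common point then map to distinct lines.
-- (ii) ⇒ (i): cut each line down to a segment containing all its intersections with the other
-- lines. The parameter of such an intersection is a ratio of cross products, so finitely many
-- of them are bounded.
module Submission where

open import Defs
open import Level using (0ℓ)
open import Algebra.Bundles using (CommutativeRing)
import Algebra.Solver.Ring.AlmostCommutativeRing as AlmostCommutativeRing
open import Data.Empty using (⊥-elim)
open import Data.Fin as Fin using (Fin; zero; suc; toℕ)
import Data.Fin.Properties as Fin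
open import Data.Integer as ℤ using (ℤ; -[1+_]; _⊖_; _◃_; ∣_∣; sign)
import Data.Integer.Properties as ℤ
open import Data.Maybe using (Maybe; just; nothing)
open import Data.Nat as ℕ using (ℕ; zero; suc)
import Data.Nat.Properties as ℕ
open import Data.Product using (Σ; _×_; _,_; proj₁; proj₂; map₂; uncurry)
open import Data.Sign as Sign using (Sign)
open import Data.Sum using (inj₁; inj₂)
open import Relation.Binary.Core using (Rel)
open import Relation.Binary.Definitions using (tri<; tri≈; tri>)
open import Relation.Binary.PropositionalEquality
open import Relation.Binary.Structures using (IsStrictTotalOrder; IsDecEquivalence)
open import Relation.Nullary using (¬_; Dec; yes; no)
open import Relation.Nullary.Decidable using (map′)
open import Relation.Unary using (Pred; Decidable)

-- The coefficients are integers: a solver with real coefficients would have to decide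
-- equality of real constants, which does not compute.
module Solver (ℝ : RealField) where
  open RealField ℝ

  commutativeRing : CommutativeRing 0ℓ 0ℓ
  commutativeRing = record { isCommutativeRing = isCommutativeRing }

  open CommutativeRing commutativeRing using
    ( +-comm; *-comm; +-identityˡ; +-identityʳ; *-identityˡ; -‿inverseʳ; zeroʳ
    ; semiring; ring; +-abelianGroup; +-commutativeSemigroup; *-commutativeSemigroup )
  open import Algebra.Properties.Semiring.Mult.TCOptimised semiring
    using (×-homo-+; ×1-homo-*; 1+×) renaming (_×_ to _×′_)
  open import Algebra.Properties.Ring ring using (-1*x≈-x)
  open import Algebra.Properties.AbelianGroup +-abelianGroup using (⁻¹-involutive; ε⁻¹≈ε; ⁻¹-∙-comm)
  open import Algebra.Properties.CommutativeSemigroup +-commutativeSemigroup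
    using () renaming (interchange to +-interchange)
  open import Algebra.Properties.CommutativeSemigroup *-commutativeSemigroup
    using () renaming (interchange to *-interchange)
  open ≡-Reasoning

  -- With the optimised multiple, fromℤ 0ℤ and fromℤ 1ℤ are 0# and 1# definitionally,
  -- so solver constants coincide with the literals.
  fromℕ : ℕ → R
  fromℕ n = n ×′ 1#

  fromℕ-suc : ∀ n → fromℕ (suc n) ≡ 1# + fromℕ n
  fromℕ-suc n = 1+× n 1#

  fromℤ : ℤ → R
  fromℤ (ℤ.+ n)  = fromℕ n
  fromℤ -[1+ n ] = - fromℕ (suc n)

  fromSign : Sign → R
  fromSign Sign.+ = 1#
  fromSign Sign.- = - 1#

  fromℤ-neg : ∀ i → fromℤ (ℤ.- i) ≡ - fromℤ i
  fromℤ-neg (ℤ.+ zero)  = sym ε⁻¹≈ε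
  fromℤ-neg (ℤ.+ suc n) = refl
  fromℤ-neg -[1+ n ]    = sym (⁻¹-involutive _)

  fromℤ-⊖ : ∀ m n → fromℤ (m ⊖ n) ≡ fromℕ m + - fromℕ n
  fromℤ-⊖ m       zero    = sym (trans (cong (fromℕ m +_) ε⁻¹≈ε) (+-identityʳ _))
  fromℤ-⊖ zero    (suc n) = sym (+-identityˡ _)
  fromℤ-⊖ (suc m) (suc n) = begin
    fromℤ (suc m ⊖ suc n)                ≡⟨ cong fromℤ (ℤ.[1+m]⊖[1+n]≡m⊖n m n) ⟩
    fromℤ (m ⊖ n)                        ≡⟨ fromℤ-⊖ m n ⟩
    fromℕ m + - fromℕ n                  ≡⟨ sym (+-identityˡ _) ⟩
    0# + (fromℕ m + - fromℕ n)           ≡⟨ cong (_+ (fromℕ m + - fromℕ n)) (sym (-‿inverseʳ 1#)) ⟩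
    (1# + - 1#) + (fromℕ m + - fromℕ n)  ≡⟨ +-interchange 1# (- 1#) (fromℕ m) (- fromℕ n) ⟩
    (1# + fromℕ m) + (- 1# + - fromℕ n)  ≡⟨ cong₂ _+_ (sym (fromℕ-suc m)) (⁻¹-∙-comm 1# (fromℕ n)) ⟩
    fromℕ (suc m) + - (1# + fromℕ n)     ≡⟨ cong (λ x → fromℕ (suc m) + - x) (sym (fromℕ-suc n)) ⟩
    fromℕ (suc m) + - fromℕ (suc n)      ∎

  fromℤ-+ : ∀ i j → fromℤ (i ℤ.+ j) ≡ fromℤ i + fromℤ j
  fromℤ-+ (ℤ.+ m)  (ℤ.+ n)  = ×-homo-+ 1# m n
  fromℤ-+ (ℤ.+ m)  -[1+ n ] = fromℤ-⊖ m (suc n)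
  fromℤ-+ -[1+ m ] (ℤ.+ n)  = trans (fromℤ-⊖ n (suc m)) (+-comm _ _)
  fromℤ-+ -[1+ m ] -[1+ n ] = begin
    - fromℕ (suc (suc (m ℕ.+ n)))          ≡⟨ cong (λ k → - fromℕ (suc k)) (sym (ℕ.+-suc m n)) ⟩
    - fromℕ (suc m ℕ.+ suc n)              ≡⟨ cong -_ (×-homo-+ 1# (suc m) (suc n)) ⟩
    - (fromℕ (suc m) + fromℕ (suc n))      ≡⟨ sym (⁻¹-∙-comm _ _) ⟩
    - fromℕ (suc m) + - fromℕ (suc n)      ∎

  fromSign-* : ∀ s t → fromSign (s Sign.* t) ≡ fromSign s * fromSign t
  fromSign-* Sign.+ t      = sym (*-identityˡ _)
  fromSign-* Sign.- Sign.+ = sym (trans (*-comm _ _) (*-identityˡ _))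
  fromSign-* Sign.- Sign.- = sym (trans (-1*x≈-x (- 1#)) (⁻¹-involutive 1#))

  fromℤ-◃ : ∀ s n → fromℤ (s ◃ n) ≡ fromSign s * fromℕ n
  fromℤ-◃ s      zero    = sym (zeroʳ _)
  fromℤ-◃ Sign.+ (suc n) = sym (*-identityˡ _)
  fromℤ-◃ Sign.- (suc n) = sym (-1*x≈-x _)

  fromℤ-signAbs : ∀ i → fromℤ i ≡ fromSign (sign i) * fromℕ ∣ i ∣
  fromℤ-signAbs i = trans (cong fromℤ (sym (ℤ.◃-inverse i))) (fromℤ-◃ (sign i) ∣ i ∣)

  fromℤ-* : ∀ i j → fromℤ (i ℤ.* j) ≡ fromℤ i * fromℤ j
  fromℤ-* i j = begin
    fromℤ (i ℤ.* j)
      ≡⟨ fromℤ-◃ (sign i Sign.* sign j) (∣ i ∣ ℕ.* ∣ j ∣) ⟩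
    fromSign (sign i Sign.* sign j) * fromℕ (∣ i ∣ ℕ.* ∣ j ∣)
      ≡⟨ cong₂ _*_ (fromSign-* (sign i) (sign j)) (×1-homo-* ∣ i ∣ ∣ j ∣) ⟩
    (σ * τ) * (fromℕ ∣ i ∣ * fromℕ ∣ j ∣)
      ≡⟨ *-interchange σ τ _ _ ⟩
    (σ * fromℕ ∣ i ∣) * (τ * fromℕ ∣ j ∣)
      ≡⟨ sym (cong₂ _*_ (fromℤ-signAbs i) (fromℤ-signAbs j)) ⟩
    fromℤ i * fromℤ j
      ∎
    where
    σ τ : R
    σ = fromSign (sign i)
    τ = fromSign (sign j)

  private
    almostCommutativeRing : AlmostCommutativeRing.AlmostCommutativeRing 0ℓ 0ℓ
    almostCommutativeRing = AlmostCommutativeRing.fromCommutativeRing commutativeRing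

    fromℤ-morphism : ℤ.+-*-rawRing AlmostCommutativeRing.-Raw-AlmostCommutative⟶ almostCommutativeRing
    fromℤ-morphism = record
      { ⟦_⟧ = fromℤ ; +-homo = fromℤ-+ ; *-homo = fromℤ-* ; -‿homo = fromℤ-neg
      ; 0-homo = refl ; 1-homo = refl }

    fromℤ-≟ : ∀ i j → Maybe (fromℤ i ≡ fromℤ j)
    fromℤ-≟ i j with i ℤ.≟ j
    ... | yes refl = just refl
    ... | no _     = nothing

  open import Algebra.Solver.Ring ℤ.+-*-rawRing almostCommutativeRing fromℤ-morphism fromℤ-≟ public
    using (solve; Polynomial; _:+_; _:*_; :-_; _:-_; _:=_; con)

module OrderedField (ℝ : RealField) where
  open RealField ℝ
  open Solver ℝ
  open IsStrictTotalOrder isStrictTotalOrder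
    using (compare; irrefl; asym; _≟_) renaming (trans to <-trans)
  open CommutativeRing commutativeRing
    using (+-comm; +-identityˡ; +-identityʳ; *-comm; zeroʳ; -‿inverseʳ; +-abelianGroup)
  open import Algebra.Properties.AbelianGroup +-abelianGroup using (ε⁻¹≈ε; ⁻¹-involutive; ∙-cancelˡ)

  <-≤-trans : ∀ {x y z} → x < y → y ≤ z → x < z
  <-≤-trans x<y (inj₁ y<z)  = <-trans x<y y<z
  <-≤-trans x<y (inj₂ refl) = x<y

  ≤-<-trans : ∀ {x y z} → x ≤ y → y < z → x < z
  ≤-<-trans (inj₁ x<y)  y<z = <-trans x<y y<z
  ≤-<-trans (inj₂ refl) y<z = y<z

  <⇒≢ : ∀ {x y} → x < y → ¬ (x ≡ y)
  <⇒≢ x<y refl = irrefl refl x<y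

  pos⇒≢0 : ∀ {x} → 0# < x → ¬ (x ≡ 0#)
  pos⇒≢0 0<x x≡0 = <⇒≢ 0<x (sym x≡0)

  +-monoʳ-< : ∀ {x y} z → x < y → z + x < z + y
  +-monoʳ-< {x} {y} z x<y = subst₂ _<_ (+-comm x z) (+-comm y z) (+-mono-< z x<y)

  +-monoʳ-≤ : ∀ {x y} z → x ≤ y → z + x ≤ z + y
  +-monoʳ-≤ z (inj₁ x<y)  = inj₁ (+-monoʳ-< z x<y)
  +-monoʳ-≤ z (inj₂ refl) = inj₂ refl

  +-monoˡ-≤ : ∀ {x y} z → x ≤ y → x + z ≤ y + z
  +-monoˡ-≤ z (inj₁ x<y)  = inj₁ (+-mono-< z x<y)
  +-monoˡ-≤ z (inj₂ refl) = inj₂ refl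

  +-mono-≤-< : ∀ {x x′ y y′} → x ≤ x′ → y < y′ → x + y < x′ + y′
  +-mono-≤-< {x′ = x′} {y = y} x≤x′ y<y′ = ≤-<-trans (+-monoˡ-≤ y x≤x′) (+-monoʳ-< x′ y<y′)

  +-pos : ∀ {x y} → 0# ≤ x → 0# < y → 0# < x + y
  +-pos 0≤x 0<y = subst (_< _) (+-identityˡ 0#) (+-mono-≤-< 0≤x 0<y)

  x≤x+y : ∀ x {y} → 0# ≤ y → x ≤ x + y
  x≤x+y x 0≤y = subst (_≤ x + _) (+-identityʳ x) (+-monoʳ-≤ x 0≤y)

  x<x+y : ∀ x {y} → 0# < y → x < x + y
  x<x+y x 0<y = subst (_< x + _) (+-identityʳ x) (+-monoʳ-< x 0<y)

  neg-antimono-< : ∀ {x y} → x < y → - y < - x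
  neg-antimono-< {x} {y} x<y = subst₂ _<_ (lhs x y) (rhs x y) (+-mono-< (- x + - y) x<y)
    where
    lhs : ∀ x y → x + (- x + - y) ≡ - y
    lhs = solve 2 (λ x y → x :+ (:- x :+ :- y) := :- y) refl
    rhs : ∀ x y → y + (- x + - y) ≡ - x
    rhs = solve 2 (λ x y → y :+ (:- x :+ :- y) := :- x) refl

  neg<0 : ∀ {x} → 0# < x → - x < 0#
  neg<0 0<x = subst (- _ <_) ε⁻¹≈ε (neg-antimono-< 0<x)

  0<neg : ∀ {x} → x < 0# → 0# < - x
  0<neg x<0 = subst (_< - _) ε⁻¹≈ε (neg-antimono-< x<0)

  0<1 : 0# < 1#
  0<1 with compare 0# 1#
  ... | tri< 0<1 _ _ = 0<1
  ... | tri≈ _ 0≡1 _ = ⊥-elim (0≢1 0≡1)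
  ... | tri> _ _ 1<0 = ⊥-elim (asym 1<0 (subst (0# <_) -1*-1≡1 (*-pos (0<neg 1<0) (0<neg 1<0))))
    where
    -1*-1≡1 : - 1# * - 1# ≡ 1#
    -1*-1≡1 = solve 0 (:- con ℤ.1ℤ :* :- con ℤ.1ℤ := con ℤ.1ℤ) refl

  x<y⇒0<y-x : ∀ {x y} → x < y → 0# < y + - x
  x<y⇒0<y-x {x} {y} x<y = subst (_< y + - x) (-‿inverseʳ x) (+-mono-< (- x) x<y)

  *-monoˡ-< : ∀ {x y c} → 0# < c → x < y → x * c < y * c
  *-monoˡ-< {x} {y} {c} 0<c x<y =
    subst₂ _<_ (+-identityˡ (x * c)) (distrib x y c) (+-mono-< (x * c) (*-pos (x<y⇒0<y-x x<y) 0<c))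
    where
    distrib : ∀ x y c → (y + - x) * c + x * c ≡ y * c
    distrib = solve 3 (λ x y c → (y :- x) :* c :+ x :* c := y :* c) refl

  -- The inverse is made total by the junk value 0⁻¹ = 0.
  infix 21 _⁻¹
  _⁻¹ : R → R
  x ⁻¹ with x ≟ 0#
  ... | yes _  = 0#
  ... | no x≢0 = proj₁ (inverse x x≢0)

  *-inverseʳ : ∀ {x} → ¬ (x ≡ 0#) → x * x ⁻¹ ≡ 1#
  *-inverseʳ {x} x≢0 with x ≟ 0#
  ... | yes x≡0 = ⊥-elim (x≢0 x≡0)
  ... | no x≢0′ = proj₂ (inverse x x≢0′)

  *-inverseˡ : ∀ {x} → ¬ (x ≡ 0#) → x ⁻¹ * x ≡ 1#
  *-inverseˡ x≢0 = trans (*-comm _ _) (*-inverseʳ x≢0)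

  *-pos-neg : ∀ {x y} → 0# < x → y < 0# → x * y < 0#
  *-pos-neg {x} {y} 0<x y<0 =
    subst (_< 0#) (solve 2 (λ x y → :- (x :* :- y) := x :* y) refl x y) (neg<0 (*-pos 0<x (0<neg y<0)))

  ⁻¹-pos : ∀ {x} → 0# < x → 0# < x ⁻¹
  ⁻¹-pos {x} 0<x with compare 0# (x ⁻¹)
  ... | tri< 0<x⁻¹ _ _ = 0<x⁻¹
  ... | tri≈ _ 0≡x⁻¹ _ =
    ⊥-elim (0≢1 (trans (sym (zeroʳ x)) (trans (cong (x *_) 0≡x⁻¹) (*-inverseʳ (pos⇒≢0 0<x)))))
  ... | tri> _ _ x⁻¹<0 =
    ⊥-elim (asym 0<1 (subst (_< 0#) (*-inverseʳ (pos⇒≢0 0<x)) (*-pos-neg 0<x x⁻¹<0)))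

  x*y≡z⇒x≡z*y⁻¹ : ∀ {x y z} → ¬ (y ≡ 0#) → x * y ≡ z → x ≡ z * y ⁻¹
  x*y≡z⇒x≡z*y⁻¹ {x} {y} {z} y≢0 x*y≡z = begin
    x                ≡⟨ solve 1 (λ x → x := x :* con ℤ.1ℤ) refl x ⟩
    x * 1#           ≡⟨ cong (x *_) (sym (*-inverseʳ y≢0)) ⟩
    x * (y * y ⁻¹)   ≡⟨ solve 3 (λ x y w → x :* (y :* w) := (x :* y) :* w) refl x y (y ⁻¹) ⟩
    (x * y) * y ⁻¹   ≡⟨ cong (_* y ⁻¹) x*y≡z ⟩
    z * y ⁻¹         ∎
    where open ≡-Reasoning

  abs : R → R
  abs x with compare x 0#
  ... | tri< _ _ _ = - x
  ... | _          = x

  abs-nonneg : ∀ x → 0# ≤ abs x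
  abs-nonneg x with compare x 0#
  ... | tri< x<0 _ _ = inj₁ (0<neg x<0)
  ... | tri≈ _ x≡0 _ = inj₂ (sym x≡0)
  ... | tri> _ _ 0<x = inj₁ 0<x

  x≤abs : ∀ x → x ≤ abs x
  x≤abs x with compare x 0#
  ... | tri< x<0 _ _ = inj₁ (<-trans x<0 (0<neg x<0))
  ... | tri≈ _ _ _   = inj₂ refl
  ... | tri> _ _ _   = inj₂ refl

  -x≤abs : ∀ x → - x ≤ abs x
  -x≤abs x with compare x 0#
  ... | tri< _ _ _   = inj₂ refl
  ... | tri≈ _ refl _ = inj₂ ε⁻¹≈ε
  ... | tri> _ _ 0<x = inj₁ (<-trans (neg<0 0<x) 0<x)

  abs<⇒bounded : ∀ {x T} → abs x < T → (- T < x) × (x < T)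
  abs<⇒bounded {x} {T} ∣x∣<T =
    subst (- T <_) (⁻¹-involutive x) (neg-antimono-< (≤-<-trans (-x≤abs x) ∣x∣<T)) ,
    ≤-<-trans (x≤abs x) ∣x∣<T

  bound : ∀ {n} → (Fin n → R) → R
  bound {zero}  f = 1#
  bound {suc n} f = abs (f zero) + bound (λ j → f (suc j))

  bound-pos : ∀ {n} (f : Fin n → R) → 0# < bound f
  bound-pos {zero}  f = 0<1
  bound-pos {suc n} f = +-pos (abs-nonneg (f zero)) (bound-pos (λ j → f (suc j)))

  abs<bound : ∀ {n} (f : Fin n → R) j → abs (f j) < bound f
  abs<bound {suc n} f zero    = x<x+y (abs (f zero)) (bound-pos (λ j → f (suc j)))
  abs<bound {suc n} f (suc j) =
    subst (_< bound f) (+-identityˡ _) (+-mono-≤-< (abs-nonneg (f zero)) (abs<bound (λ j → f (suc j)) j))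

  fromℕ-nonneg : ∀ n → 0# ≤ fromℕ n
  0<fromℕ-suc : ∀ n → 0# < fromℕ (suc n)

  fromℕ-nonneg zero    = inj₂ refl
  fromℕ-nonneg (suc n) = inj₁ (0<fromℕ-suc n)

  0<fromℕ-suc n = subst (0# <_) (sym (fromℕ-suc n)) (<-≤-trans 0<1 (x≤x+y 1# (fromℕ-nonneg n)))

  fromℕ-injective : ∀ {m n} → fromℕ m ≡ fromℕ n → m ≡ n
  fromℕ-injective {zero}  {zero}  _ = refl
  fromℕ-injective {zero}  {suc n} e = ⊥-elim (<⇒≢ (0<fromℕ-suc n) e)
  fromℕ-injective {suc m} {zero}  e = ⊥-elim (<⇒≢ (0<fromℕ-suc m) (sym e))
  fromℕ-injective {suc m} {suc n} e =
    cong suc (fromℕ-injective (∙-cancelˡ 1# _ _ (trans (sym (fromℕ-suc m)) (trans e (fromℕ-suc n)))))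

module Geometry (ℝ : RealField) where
  open RealField ℝ
  open Plane ℝ
  open Solver ℝ
  open OrderedField ℝ using (_⁻¹; *-inverseˡ; *-inverseʳ; x<y⇒0<y-x; *-monoˡ-<; ⁻¹-pos; pos⇒≢0)
  open IsStrictTotalOrder isStrictTotalOrder using (_≟_) renaming (trans to <-trans)
  open CommutativeRing commutativeRing using (+-group)
  open import Algebra.Properties.Group +-group using (x∙y⁻¹≈ε⇒x≈y)
  open ≡-Reasoning

  cross : Point → Point → R
  cross (x₁ , y₁) (x₂ , y₂) = x₁ * y₂ + - (y₁ * x₂)

  private
    Pointᴾ : ℕ → Set
    Pointᴾ n = Polynomial n × Polynomial n

    _-ᴾ_ : ∀ {n} → Pointᴾ n → Pointᴾ n → Pointᴾ n
    (x₁ , y₁) -ᴾ (x₂ , y₂) = (x₁ :- x₂) , (y₁ :- y₂)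

    affineᴾ : ∀ {n} → Pointᴾ n → Pointᴾ n → Polynomial n → Pointᴾ n
    affineᴾ (x₁ , y₁) (x₂ , y₂) t = (x₁ :+ t :* (x₂ :- x₁)) , (y₁ :+ t :* (y₂ :- y₁))

    crossᴾ : ∀ {n} → Pointᴾ n → Pointᴾ n → Polynomial n
    crossᴾ (x₁ , y₁) (x₂ , y₂) = x₁ :* y₂ :- y₁ :* x₂

  affine-zero : ∀ a b → affine a b 0# ≡ a
  affine-zero (a₁ , a₂) (b₁ , b₂) = cong₂ _,_ (coordinate a₁ b₁) (coordinate a₂ b₂)
    where
    coordinate : ∀ a b → a + 0# * (b + - a) ≡ a
    coordinate = solve 2 (λ a b → a :+ con ℤ.0ℤ :* (b :- a) := a) refl

  affine-one : ∀ a b → affine a b 1# ≡ b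
  affine-one (a₁ , a₂) (b₁ , b₂) = cong₂ _,_ (coordinate a₁ b₁) (coordinate a₂ b₂)
    where
    coordinate : ∀ a b → a + 1# * (b + - a) ≡ b
    coordinate = solve 2 (λ a b → a :+ con ℤ.1ℤ :* (b :- a) := b) refl

  affine-affine : ∀ a b t₁ t₂ s →
    affine (affine a b t₁) (affine a b t₂) s ≡ affine a b (t₁ + s * (t₂ + - t₁))
  affine-affine (a₁ , a₂) (b₁ , b₂) t₁ t₂ s =
    cong₂ _,_ (coordinate a₁ b₁ t₁ t₂ s) (coordinate a₂ b₂ t₁ t₂ s)
    where
    coordinate : ∀ a b t₁ t₂ s →
      (a + t₁ * (b + - a)) + s * ((a + t₂ * (b + - a)) + - (a + t₁ * (b + - a)))
        ≡ a + (t₁ + s * (t₂ + - t₁)) * (b + - a)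
    coordinate = solve 5 (λ a b t₁ t₂ s →
      (a :+ t₁ :* (b :- a)) :+ s :* ((a :+ t₂ :* (b :- a)) :- (a :+ t₁ :* (b :- a)))
      := a :+ (t₁ :+ s :* (t₂ :- t₁)) :* (b :- a)) refl

  cross-affine : ∀ a b t → cross (b -ᵖ a) (affine a b t -ᵖ a) ≡ 0#
  cross-affine (a₁ , a₂) (b₁ , b₂) = solve 5 (λ a₁ a₂ b₁ b₂ t →
      let a = a₁ , a₂ ; b = b₁ , b₂ in
      crossᴾ (b -ᴾ a) (affineᴾ a b t -ᴾ a) := con ℤ.0ℤ)
    refl a₁ a₂ b₁ b₂

  cross-collinear : ∀ a b t₁ t₂ t₃ →
    cross (affine a b t₂ -ᵖ affine a b t₁) (affine a b t₃ -ᵖ affine a b t₁) ≡ 0#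
  cross-collinear (a₁ , a₂) (b₁ , b₂) = solve 7 (λ a₁ a₂ b₁ b₂ t₁ t₂ t₃ →
      let a = a₁ , a₂ ; b = b₁ , b₂ in
      crossᴾ (affineᴾ a b t₂ -ᴾ affineᴾ a b t₁) (affineᴾ a b t₃ -ᴾ affineᴾ a b t₁) := con ℤ.0ℤ)
    refl a₁ a₂ b₁ b₂

  cross-affine-shift : ∀ a b c d r s →
    cross (b -ᵖ a) (affine c d r -ᵖ a)
      ≡ cross (b -ᵖ a) (affine c d s -ᵖ a) + (r + - s) * cross (b -ᵖ a) (d -ᵖ c)
  cross-affine-shift (a₁ , a₂) (b₁ , b₂) (c₁ , c₂) (d₁ , d₂) =
    solve 10 (λ a₁ a₂ b₁ b₂ c₁ c₂ d₁ d₂ r s →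
      let a = a₁ , a₂ ; b = b₁ , b₂ ; c = c₁ , c₂ ; d = d₁ , d₂ in
      crossᴾ (b -ᴾ a) (affineᴾ c d r -ᴾ a)
        := crossᴾ (b -ᴾ a) (affineᴾ c d s -ᴾ a) :+ (r :- s) :* crossᴾ (b -ᴾ a) (d -ᴾ c))
    refl a₁ a₂ b₁ b₂ c₁ c₂ d₁ d₂

  cross-affine-parameter : ∀ a b c d t →
    cross (d -ᵖ c) (affine a b t -ᵖ c) ≡ cross (c -ᵖ a) (d -ᵖ c) + - (t * cross (b -ᵖ a) (d -ᵖ c))
  cross-affine-parameter (a₁ , a₂) (b₁ , b₂) (c₁ , c₂) (d₁ , d₂) =
    solve 9 (λ a₁ a₂ b₁ b₂ c₁ c₂ d₁ d₂ t →
      let a = a₁ , a₂ ; b = b₁ , b₂ ; c = c₁ , c₂ ; d = d₁ , d₂ in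
      crossᴾ (d -ᴾ c) (affineᴾ a b t -ᴾ c) := crossᴾ (c -ᴾ a) (d -ᴾ c) :- t :* crossᴾ (b -ᴾ a) (d -ᴾ c))
    refl a₁ a₂ b₁ b₂ c₁ c₂ d₁ d₂

  OnLine⇒cross≡0 : ∀ ℓ {x} → OnLine ℓ x → cross (Line.q ℓ -ᵖ Line.p ℓ) (x -ᵖ Line.p ℓ) ≡ 0#
  OnLine⇒cross≡0 (line a b _) (t , refl) = cross-affine a b t

  private
    difference≡0 : ∀ {a b} → b + - a ≡ 0# → a ≡ b
    difference≡0 {a} {b} e = sym (x∙y⁻¹≈ε⇒x≈y b a e)

    parameter : ∀ a₁ a₂ b₁ b₂ x₁ x₂ → ¬ (b₁ + - a₁ ≡ 0#) →
      (b₁ + - a₁) * (x₂ + - a₂) ≡ (b₂ + - a₂) * (x₁ + - a₁) →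
      Σ R λ t → (x₁ ≡ a₁ + t * (b₁ + - a₁)) × (x₂ ≡ a₂ + t * (b₂ + - a₂))
    parameter a₁ a₂ b₁ b₂ x₁ x₂ δ≢0 products≡ = (x₁ + - a₁) * δ ⁻¹ , first , second
      where
      δ : R
      δ = b₁ + - a₁
      first : x₁ ≡ a₁ + ((x₁ + - a₁) * δ ⁻¹) * δ
      first = begin
        x₁
          ≡⟨ solve 2 (λ a₁ x₁ → x₁ := a₁ :+ (x₁ :- a₁) :* con ℤ.1ℤ) refl a₁ x₁ ⟩
        a₁ + (x₁ + - a₁) * 1#
          ≡⟨ cong (λ z → a₁ + (x₁ + - a₁) * z) (sym (*-inverseˡ δ≢0)) ⟩
        a₁ + (x₁ + - a₁) * (δ ⁻¹ * δ)
          ≡⟨ solve 4 (λ a₁ x₁ w δ → a₁ :+ (x₁ :- a₁) :* (w :* δ) := a₁ :+ ((x₁ :- a₁) :* w) :* δ)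
               refl a₁ x₁ (δ ⁻¹) δ ⟩
        a₁ + ((x₁ + - a₁) * δ ⁻¹) * δ
          ∎
      second : x₂ ≡ a₂ + ((x₁ + - a₁) * δ ⁻¹) * (b₂ + - a₂)
      second = begin
        x₂
          ≡⟨ solve 2 (λ a₂ x₂ → x₂ := a₂ :+ con ℤ.1ℤ :* (x₂ :- a₂)) refl a₂ x₂ ⟩
        a₂ + 1# * (x₂ + - a₂)
          ≡⟨ cong (λ z → a₂ + z * (x₂ + - a₂)) (sym (*-inverseˡ δ≢0)) ⟩
        a₂ + (δ ⁻¹ * δ) * (x₂ + - a₂)
          ≡⟨ solve 4 (λ a₂ x₂ w δ → a₂ :+ (w :* δ) :* (x₂ :- a₂) := a₂ :+ w :* (δ :* (x₂ :- a₂)))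
               refl a₂ x₂ (δ ⁻¹) δ ⟩
        a₂ + δ ⁻¹ * (δ * (x₂ + - a₂))
          ≡⟨ cong (λ z → a₂ + δ ⁻¹ * z) products≡ ⟩
        a₂ + δ ⁻¹ * ((b₂ + - a₂) * (x₁ + - a₁))
          ≡⟨ solve 5 (λ a₁ a₂ x₁ w β → a₂ :+ w :* (β :* (x₁ :- a₁)) := a₂ :+ ((x₁ :- a₁) :* w) :* β)
               refl a₁ a₂ x₁ (δ ⁻¹) (b₂ + - a₂) ⟩
        a₂ + ((x₁ + - a₁) * δ ⁻¹) * (b₂ + - a₂)
          ∎

  cross≡0⇒OnLine : ∀ ℓ x → cross (Line.q ℓ -ᵖ Line.p ℓ) (x -ᵖ Line.p ℓ) ≡ 0# → OnLine ℓ x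
  cross≡0⇒OnLine (line (a₁ , a₂) (b₁ , b₂) a≢b) (x₁ , x₂) cross≡0 =
    byCoordinate (b₁ + - a₁ ≟ 0#) (b₂ + - a₂ ≟ 0#)
    where
    products≡ : (b₁ + - a₁) * (x₂ + - a₂) ≡ (b₂ + - a₂) * (x₁ + - a₁)
    products≡ = x∙y⁻¹≈ε⇒x≈y _ _ cross≡0
    byCoordinate : Dec (b₁ + - a₁ ≡ 0#) → Dec (b₂ + - a₂ ≡ 0#) →
      OnLine (line (a₁ , a₂) (b₁ , b₂) a≢b) (x₁ , x₂)
    byCoordinate (no δ₁≢0) _ =
      map₂ (uncurry (cong₂ _,_)) (parameter a₁ a₂ b₁ b₂ x₁ x₂ δ₁≢0 products≡)
    byCoordinate (yes _) (no δ₂≢0) =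
      map₂ (uncurry (λ e₂ e₁ → cong₂ _,_ e₁ e₂)) (parameter a₂ a₁ b₂ b₁ x₂ x₁ δ₂≢0 (sym products≡))
    byCoordinate (yes δ₁≡0) (yes δ₂≡0) =
      ⊥-elim (a≢b (cong₂ _,_ (difference≡0 δ₁≡0) (difference≡0 δ₂≡0)))

  onLine? : ∀ ℓ x → Dec (OnLine ℓ x)
  onLine? ℓ x =
    map′ (cross≡0⇒OnLine ℓ x) (OnLine⇒cross≡0 ℓ) (cross (Line.q ℓ -ᵖ Line.p ℓ) (x -ᵖ Line.p ℓ) ≟ 0#)

  p∈line : ∀ ℓ → OnLine ℓ (Line.p ℓ)
  p∈line (line a b _) = 0# , sym (affine-zero a b)

  q∈line : ∀ ℓ → OnLine ℓ (Line.q ℓ)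
  q∈line (line a b _) = 1# , sym (affine-one a b)

  affine-OnLine : ∀ ℓ {c d} → OnLine ℓ c → OnLine ℓ d → ∀ s → OnLine ℓ (affine c d s)
  affine-OnLine (line a b _) (t₁ , refl) (t₂ , refl) s = t₁ + s * (t₂ + - t₁) , affine-affine a b t₁ t₂ s

  collinear-OnLine : ∀ ℓ {c d x} (c≢d : ¬ (c ≡ d)) →
    OnLine ℓ c → OnLine ℓ d → OnLine ℓ x → OnLine (line c d c≢d) x
  collinear-OnLine (line a b _) c≢d (t₁ , refl) (t₂ , refl) (t₃ , refl) =
    cross≡0⇒OnLine (line _ _ c≢d) _ (cross-collinear a b t₁ t₂ t₃)

  SameLine-refl : ∀ {ℓ} → SameLine ℓ ℓ
  SameLine-refl x = (λ x∈ℓ → x∈ℓ) , (λ x∈ℓ → x∈ℓ)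

  SameLine-sym : ∀ {ℓ ℓ′} → SameLine ℓ ℓ′ → SameLine ℓ′ ℓ
  SameLine-sym ℓ≡ℓ′ x = proj₂ (ℓ≡ℓ′ x) , proj₁ (ℓ≡ℓ′ x)

  SameLine-trans : ∀ {ℓ ℓ′ ℓ″} → SameLine ℓ ℓ′ → SameLine ℓ′ ℓ″ → SameLine ℓ ℓ″
  SameLine-trans ℓ≡ℓ′ ℓ′≡ℓ″ x =
    (λ x∈ℓ → proj₁ (ℓ′≡ℓ″ x) (proj₁ (ℓ≡ℓ′ x) x∈ℓ)) ,
    (λ x∈ℓ″ → proj₂ (ℓ≡ℓ′ x) (proj₂ (ℓ′≡ℓ″ x) x∈ℓ″))

  SameLine-through : ∀ ℓ {c d} (c≢d : ¬ (c ≡ d)) → OnLine ℓ c → OnLine ℓ d → SameLine ℓ (line c d c≢d)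
  SameLine-through ℓ c≢d c∈ℓ d∈ℓ x =
    collinear-OnLine ℓ c≢d c∈ℓ d∈ℓ , λ { (s , refl) → affine-OnLine ℓ c∈ℓ d∈ℓ s }

  two-points⇒SameLine : ∀ ℓ ℓ′ {c d} → ¬ (c ≡ d) →
    OnLine ℓ c → OnLine ℓ d → OnLine ℓ′ c → OnLine ℓ′ d → SameLine ℓ ℓ′
  two-points⇒SameLine ℓ ℓ′ c≢d c∈ℓ d∈ℓ c∈ℓ′ d∈ℓ′ =
    SameLine-trans {ℓ} {line _ _ c≢d} {ℓ′} (SameLine-through ℓ c≢d c∈ℓ d∈ℓ)
      (SameLine-sym {ℓ′} {line _ _ c≢d} (SameLine-through ℓ′ c≢d c∈ℓ′ d∈ℓ′))

  sameLine? : ∀ ℓ ℓ′ → Dec (SameLine ℓ ℓ′)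
  sameLine? ℓ ℓ′@(line c d c≢d) with onLine? ℓ c | onLine? ℓ d
  ... | yes c∈ℓ | yes d∈ℓ = yes (SameLine-through ℓ c≢d c∈ℓ d∈ℓ)
  ... | no c∉ℓ  | _       = no (λ ℓ≡ℓ′ → c∉ℓ (proj₂ (ℓ≡ℓ′ c) (p∈line ℓ′)))
  ... | yes _   | no d∉ℓ  = no (λ ℓ≡ℓ′ → d∉ℓ (proj₂ (ℓ≡ℓ′ d) (q∈line ℓ′)))

  parallel-meeting⇒SameLine : ∀ {a b c d t s} (a≢b : ¬ (a ≡ b)) (c≢d : ¬ (c ≡ d)) →
    cross (b -ᵖ a) (d -ᵖ c) ≡ 0# → affine a b t ≡ affine c d s → SameLine (line a b a≢b) (line c d c≢d)
  parallel-meeting⇒SameLine {a} {b} {c} {d} {t} {s} a≢b c≢d parallel meet =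
    SameLine-through ℓ c≢d
      (subst (OnLine ℓ) (affine-zero c d) (cd⊆ℓ 0#)) (subst (OnLine ℓ) (affine-one c d) (cd⊆ℓ 1#))
    where
    ℓ : Line
    ℓ = line a b a≢b
    ab∩cd∈ab : cross (b -ᵖ a) (affine c d s -ᵖ a) ≡ 0#
    ab∩cd∈ab = trans (cong (λ x → cross (b -ᵖ a) (x -ᵖ a)) (sym meet)) (cross-affine a b t)
    cd⊆ℓ : ∀ r → OnLine ℓ (affine c d r)
    cd⊆ℓ r = cross≡0⇒OnLine ℓ _ (begin
      cross (b -ᵖ a) (affine c d r -ᵖ a)
        ≡⟨ cross-affine-shift a b c d r s ⟩
      cross (b -ᵖ a) (affine c d s -ᵖ a) + (r + - s) * cross (b -ᵖ a) (d -ᵖ c)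
        ≡⟨ cong₂ (λ x y → x + (r + - s) * y) ab∩cd∈ab parallel ⟩
      0# + (r + - s) * 0#
        ≡⟨ solve 1 (λ u → con ℤ.0ℤ :+ u :* con ℤ.0ℤ := con ℤ.0ℤ) refl (r + - s) ⟩
      0# ∎)

  intersection-parameter : ∀ a b c d {t s} → affine a b t ≡ affine c d s →
    t * cross (b -ᵖ a) (d -ᵖ c) ≡ cross (c -ᵖ a) (d -ᵖ c)
  intersection-parameter a b c d {t} {s} meet = sym (x∙y⁻¹≈ε⇒x≈y _ _ (begin
    cross (c -ᵖ a) (d -ᵖ c) + - (t * cross (b -ᵖ a) (d -ᵖ c)) ≡⟨ sym (cross-affine-parameter a b c d t) ⟩
    cross (d -ᵖ c) (affine a b t -ᵖ c)                          ≡⟨ cong (λ p → cross (d -ᵖ c) (p -ᵖ c)) meet ⟩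
    cross (d -ᵖ c) (affine c d s -ᵖ c)                          ≡⟨ cross-affine c d s ⟩
    0#                                                          ∎))

  affine-injective : ∀ {a b} → ¬ (a ≡ b) → ∀ {s t} → affine a b s ≡ affine a b t → s ≡ t
  affine-injective {a₁ , a₂} {b₁ , b₂} a≢b {s} {t} eq with s ≟ t
  ... | yes s≡t = s≡t
  ... | no s≢t  = ⊥-elim (a≢b (cong₂ _,_ (coordinate (cong proj₁ eq)) (coordinate (cong proj₂ eq))))
    where
    w : R
    w = (s + - t) ⁻¹
    s-t≢0 : ¬ (s + - t ≡ 0#)
    s-t≢0 s-t≡0 = s≢t (x∙y⁻¹≈ε⇒x≈y s t s-t≡0)
    coordinate : ∀ {a b} → a + s * (b + - a) ≡ a + t * (b + - a) → a ≡ b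
    coordinate {a} {b} eqₐ = sym (x∙y⁻¹≈ε⇒x≈y b a (begin
      b + - a
        ≡⟨ solve 2 (λ a b → b :- a := con ℤ.1ℤ :* (b :- a)) refl a b ⟩
      1# * (b + - a)
        ≡⟨ cong (_* (b + - a)) (sym (*-inverseˡ s-t≢0)) ⟩
      (w * (s + - t)) * (b + - a)
        ≡⟨ solve 5 (λ a b s t w → (w :* (s :- t)) :* (b :- a)
                      := w :* ((a :+ s :* (b :- a)) :- (a :+ t :* (b :- a)))) refl a b s t w ⟩
      w * ((a + s * (b + - a)) + - (a + t * (b + - a)))
        ≡⟨ cong (λ z → w * (z + - (a + t * (b + - a)))) eqₐ ⟩
      w * ((a + t * (b + - a)) + - (a + t * (b + - a)))
        ≡⟨ solve 2 (λ w z → w :* (z :- z) := con ℤ.0ℤ) refl w (a + t * (b + - a)) ⟩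
      0#
        ∎))

  between⇒OnSeg : ∀ {a b r s t} (ends≢ : ¬ (affine a b r ≡ affine a b s)) → r < t → t < s →
    OnSeg (seg (affine a b r) (affine a b s) ends≢) (affine a b t)
  between⇒OnSeg {a} {b} {r} {s} {t} _ r<t t<s = u , inj₁ 0<u , inj₁ u<1 , sym (begin
    affine (affine a b r) (affine a b s) u ≡⟨ affine-affine a b r s u ⟩
    affine a b (r + u * (s + - r))         ≡⟨ cong (affine a b) r+u*w≡t ⟩
    affine a b t                           ∎)
    where
    w : R
    w = s + - r
    0<w : 0# < w
    0<w = x<y⇒0<y-x (<-trans r<t t<s)
    w≢0 : ¬ (w ≡ 0#)
    w≢0 = pos⇒≢0 0<w
    u : R
    u = (t + - r) * w ⁻¹
    0<u : 0# < u
    0<u = *-pos (x<y⇒0<y-x r<t) (⁻¹-pos 0<w)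
    u<1 : u < 1#
    u<1 = subst (u <_) (*-inverseʳ w≢0) (*-monoˡ-< (⁻¹-pos 0<w) (+-mono-< (- r) t<s))
    r+u*w≡t : r + u * w ≡ t
    r+u*w≡t = begin
      r + ((t + - r) * w ⁻¹) * w
        ≡⟨ solve 4 (λ r t v w → r :+ ((t :- r) :* v) :* w := r :+ (t :- r) :* (w :* v)) refl r t (w ⁻¹) w ⟩
      r + (t + - r) * (w * w ⁻¹)
        ≡⟨ cong (λ z → r + (t + - r) * z) (*-inverseʳ w≢0) ⟩
      r + (t + - r) * 1#
        ≡⟨ solve 2 (λ r t → r :+ (t :- r) :* con ℤ.1ℤ := t) refl r t ⟩
      t
        ∎

  OnSeg⇒OnLine : ∀ σ {x} → OnSeg σ x → OnLine (supportLine σ) x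
  OnSeg⇒OnLine (seg a b _) (t , _ , _ , x≡) = t , x≡

  vertical : R → Line
  vertical K = line (K , 0#) (K , 1#) (λ eq → 0≢1 (cong proj₂ eq))

  OnLine-vertical : ∀ {K x} → OnLine (vertical K) x → proj₁ x ≡ K
  OnLine-vertical {K} (t , refl) = solve 2 (λ K t → K :+ t :* (K :- K) := K) refl K t

first : ∀ {n p} (P : Pred (Fin n) p) → Decidable P → ∀ {i} → P i →
  Σ (Fin n) λ k → P k × (∀ {j} → P j → k Fin.≤ j)
first P P? {zero} P0 = zero , P0 , λ _ → ℕ.z≤n
first P P? {suc i} Psi with P? zero
... | yes P0  = zero , P0 , λ _ → ℕ.z≤n
... | no ¬P0 with first (λ j → P (suc j)) (λ j → P? (suc j)) Psi
...   | k , Pk , k-least =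
  suc k , Pk , λ { {zero} P0 → ⊥-elim (¬P0 P0) ; {suc j} Pj → ℕ.s≤s (k-least Pj) }

module Canonical {n ℓ} {_≈_ : Rel (Fin n) ℓ} (isDecEquivalence : IsDecEquivalence _≈_) where
  open IsDecEquivalence isDecEquivalence renaming (refl to ≈-refl; sym to ≈-sym; trans to ≈-trans)

  private
    least : ∀ i → Σ (Fin n) λ k → k ≈ i × (∀ {j} → j ≈ i → k Fin.≤ j)
    least i = first (_≈ i) (_≟ i) ≈-refl

  canonical : Fin n → Fin n
  canonical i = proj₁ (least i)

  canonical-≈ : ∀ i → canonical i ≈ i
  canonical-≈ i = proj₁ (proj₂ (least i))

  canonical-cong : ∀ {i j} → i ≈ j → canonical i ≡ canonical j
  canonical-cong {i} {j} i≈j = Fin.≤-antisym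
    (proj₂ (proj₂ (least i)) (≈-trans (canonical-≈ j) (≈-sym i≈j)))
    (proj₂ (proj₂ (least j)) (≈-trans (canonical-≈ i) i≈j))

module Transfer (ℝ : RealField) where
  open Plane ℝ
  open EFL using (InP; HasEFLColoring)

  InP-partner : ∀ {A : Set} (On : A → Point → Set) {m} (M : Fin m → A) {p} i →
    InP On M p → On (M i) p → Σ (Fin m) λ j → ¬ (i ≡ j) × On (M j) p
  InP-partner On M i (j , k , j≢k , p∈j , p∈k) p∈i with i Fin.≟ j
  ... | yes refl = k , j≢k , p∈k
  ... | no i≢j   = j , i≢j , p∈j

  pullback : ∀ {A B : Set} (On₁ : A → Point → Set) (On₂ : B → Point → Set)
    {m n k} (M : Fin m → A) (N : Fin n → B) (φ : Fin m → Fin n) →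
    (∀ {p} → InP On₁ M p → InP On₂ N p) →
    (∀ {p} i → InP On₁ M p → On₁ (M i) p → On₂ (N (φ i)) p) →
    HasEFLColoring On₂ N k → HasEFLColoring On₁ M k
  pullback On₁ On₂ M N φ P⊆P on (f , f-point , f-proper) =
    (λ (p , h) → f (p , P⊆P h)) ,
    (λ p h h′ → f-point p (P⊆P h) (P⊆P h′)) ,
    λ (x , hx) (y , hy) i x≢y x∈i y∈i →
      f-proper (x , P⊆P hx) (y , P⊆P hy) (φ i) x≢y (on i hx x∈i) (on i hy y∈i)

module EnclosingSegments (ℝ : RealField) {m} (L : Plane.LineSet ℝ m) where
  open RealField ℝ
  open Plane ℝ
  open Transfer ℝ using (InP-partner)
  open OrderedField ℝ
  open Geometry ℝ
  open IsStrictTotalOrder isStrictTotalOrder using () renaming (trans to <-trans)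

  private
    ℓ : Fin m → Line
    ℓ = proj₁ L
    p q : Fin m → Point
    p i = Line.p (ℓ i)
    q i = Line.q (ℓ i)

  -- The parameter on ℓ i of the intersection with ℓ j, when they are not parallel.
  crossing : Fin m → Fin m → R
  crossing i j = cross (p j -ᵖ p i) (q j -ᵖ p j) * cross (q i -ᵖ p i) (q j -ᵖ p j) ⁻¹

  radius : Fin m → R
  radius i = bound (crossing i)

  end⁻ end⁺ : Fin m → Point
  end⁻ i = affine (p i) (q i) (- radius i)
  end⁺ i = affine (p i) (q i) (radius i)

  end⁻∈ℓ : ∀ i → OnLine (ℓ i) (end⁻ i)
  end⁻∈ℓ i = - radius i , refl

  end⁺∈ℓ : ∀ i → OnLine (ℓ i) (end⁺ i)
  end⁺∈ℓ i = radius i , refl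

  ends≢ : ∀ i → ¬ (end⁻ i ≡ end⁺ i)
  ends≢ i ends≡ = <⇒≢ (<-trans (neg<0 (bound-pos (crossing i))) (bound-pos (crossing i)))
    (affine-injective (Line.p≢q (ℓ i)) ends≡)

  segment : Fin m → Segment
  segment i = seg (end⁻ i) (end⁺ i) (ends≢ i)

  crossing-parameter : ∀ {i j t s} → ¬ (i ≡ j) →
    affine (p i) (q i) t ≡ affine (p j) (q j) s → t ≡ crossing i j
  crossing-parameter {i} {j} i≢j meet =
    x*y≡z⇒x≡z*y⁻¹ not-parallel (intersection-parameter (p i) (q i) (p j) (q j) meet)
    where
    not-parallel : ¬ (cross (q i -ᵖ p i) (q j -ᵖ p j) ≡ 0#)
    not-parallel parallel =
      proj₂ L i j i≢j (parallel-meeting⇒SameLine (Line.p≢q (ℓ i)) (Line.p≢q (ℓ j)) parallel meet)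

  enclose : ∀ {i j x} → ¬ (i ≡ j) → OnLine (ℓ i) x → OnLine (ℓ j) x → OnSeg (segment i) x
  enclose {i} {j} i≢j (t , refl) (s , meet) = between⇒OnSeg (ends≢ i) (proj₁ inside) (proj₂ inside)
    where
    inside : (- radius i < t) × (t < radius i)
    inside = abs<⇒bounded
      (subst (λ z → abs z < radius i) (sym (crossing-parameter i≢j meet)) (abs<bound (crossing i) j))

  InP-enclosed : ∀ {x} → EFL.InP OnLine ℓ x → EFL.InP OnSeg segment x
  InP-enclosed (i , j , i≢j , x∈i , x∈j) =
    i , j , i≢j , enclose i≢j x∈i x∈j , enclose (λ j≡i → i≢j (sym j≡i)) x∈j x∈i

  OnLine-enclosed : ∀ {x} i → EFL.InP OnLine ℓ x → OnLine (ℓ i) x → OnSeg (segment i) x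
  OnLine-enclosed i x∈P x∈i with InP-partner OnLine ℓ i x∈P x∈i
  ... | j , i≢j , x∈j = enclose i≢j x∈i x∈j

  segmentSet : SegmentSet m
  segmentSet = segment , λ i j i≢j (collinear , _) → proj₂ L i j i≢j
    (two-points⇒SameLine (ℓ i) (ℓ j) (ends≢ j)
      (onℓ i (proj₁ collinear)) (onℓ i (proj₂ collinear)) (end⁻∈ℓ j) (end⁺∈ℓ j))
    where
    onℓ : ∀ i {x} → OnLine (supportLine (segment i)) x → OnLine (ℓ i) x
    onℓ i (s , refl) = affine-OnLine (ℓ i) (end⁻∈ℓ i) (end⁺∈ℓ i) s

module SupportLines (ℝ : RealField) {m} (S : Plane.SegmentSet ℝ m) where
  open RealField ℝ
  open Plane ℝ
  open Solver ℝ using (fromℕ)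
  open OrderedField ℝ
  open Geometry ℝ
  open CommutativeRing (Solver.commutativeRing ℝ) using (+-group)
  open import Algebra.Properties.Group +-group using (∙-cancelˡ)

  private
    σ : Fin m → Segment
    σ = proj₁ S

  support : Fin m → Line
  support i = supportLine (σ i)

  sameSupport : IsDecEquivalence (λ i j → SameLine (support i) (support j))
  sameSupport = record
    { isEquivalence = record
      { refl  = λ {i} → SameLine-refl {support i}
      ; sym   = λ {i} {j} → SameLine-sym {support i} {support j}
      ; trans = λ {i} {j} {k} → SameLine-trans {support i} {support j} {support k}
      }
    ; _≟_ = λ i j → sameLine? (support i) (support j)
    }

  open Canonical sameSupport public

  canonical-idem : ∀ i → canonical (canonical i) ≡ canonical i
  canonical-idem i = canonical-cong (canonical-≈ i)

  far : Fin m → R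
  far i = bound (λ j → proj₁ (Segment.a (σ j))) + fromℕ (toℕ i)

  a<far : ∀ i j → proj₁ (Segment.a (σ j)) < far i
  a<far i j = ≤-<-trans (x≤abs _)
    (<-≤-trans (abs<bound (λ j → proj₁ (Segment.a (σ j))) j) (x≤x+y _ (fromℕ-nonneg (toℕ i))))

  chosen : ∀ i → Dec (canonical i ≡ i) → Line
  chosen i (yes _) = support i
  chosen i (no _)  = vertical (far i)

  lines : Fin m → Line
  lines i = chosen i (canonical i Fin.≟ i)

  lines-canonical : ∀ i → canonical i ≡ i → lines i ≡ support i
  lines-canonical i canonical≡ with canonical i Fin.≟ i
  ... | yes _ = refl
  ... | no canonical≢ = ⊥-elim (canonical≢ canonical≡)

  support≢vertical : ∀ i j → ¬ SameLine (support i) (vertical (far j))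
  support≢vertical i j same = <⇒≢ (a<far j i) (OnLine-vertical (proj₁ (same _) (p∈line (support i))))

  chosen-distinct : ∀ {i j} (i? : Dec (canonical i ≡ i)) (j? : Dec (canonical j ≡ j)) → ¬ (i ≡ j) →
    ¬ SameLine (chosen i i?) (chosen j j?)
  chosen-distinct {i} {j} (yes i-canonical) (yes j-canonical) i≢j same =
    i≢j (trans (sym i-canonical) (trans (canonical-cong same) j-canonical))
  chosen-distinct {i} {j} (yes _) (no _) i≢j same = support≢vertical i j same
  chosen-distinct {i} {j} (no _) (yes _) i≢j same =
    support≢vertical j i (SameLine-sym {vertical (far i)} {support j} same)
  chosen-distinct {i} {j} (no _) (no _) i≢j same =
    i≢j (Fin.toℕ-injective (fromℕ-injective (∙-cancelˡ _ _ _ far≡)))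
    where
    far≡ : far i ≡ far j
    far≡ = OnLine-vertical (proj₁ (same _) (p∈line (vertical (far i))))

  lineSet : LineSet m
  lineSet = lines , λ i j → chosen-distinct (canonical i Fin.≟ i) (canonical j Fin.≟ j)

  OnSeg⇒OnLine-canonical : ∀ i {x} → OnSeg (σ i) x → OnLine (lines (canonical i)) x
  OnSeg⇒OnLine-canonical i {x} x∈σ = subst (λ ℓ → OnLine ℓ x) (sym (lines-canonical _ (canonical-idem i)))
    (proj₂ (canonical-≈ i x) (OnSeg⇒OnLine (σ i) x∈σ))

  canonical-separates : ∀ {i j x} → ¬ (i ≡ j) →
    OnSeg (σ i) x → OnSeg (σ j) x → ¬ (canonical i ≡ canonical j)
  canonical-separates {i} {j} {x} i≢j x∈i x∈j canonical≡ = proj₂ S i j i≢j (collinear , x , x∈i , x∈j)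
    where
    same : SameLine (support i) (support j)
    same = SameLine-trans {support i} {support (canonical i)} {support j}
      (SameLine-sym {support (canonical i)} {support i} (canonical-≈ i))
      (subst (λ k → SameLine (support k) (support j)) (sym canonical≡) (canonical-≈ j))
    collinear : Collinear (σ i) (σ j)
    collinear = proj₂ (same _) (p∈line (support j)) , proj₂ (same _) (q∈line (support j))

  InP-canonical : ∀ {x} → EFL.InP OnSeg σ x → EFL.InP OnLine lines x
  InP-canonical (i , j , i≢j , x∈i , x∈j) =
    canonical i , canonical j , canonical-separates i≢j x∈i x∈j ,
    OnSeg⇒OnLine-canonical i x∈i , OnSeg⇒OnLine-canonical j x∈j

proposition5 : (ℝ : RealField) (m : ℕ) →
    (Plane.EFLLines ℝ m → Plane.EFLSegments ℝ m) × (Plane.EFLSegments ℝ m → Plane.EFLLines ℝ m)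
proposition5 ℝ m = lines⇒segments , segments⇒lines
  where
  open Plane ℝ
  open Transfer ℝ using (pullback)

  lines⇒segments : EFLLines m → EFLSegments m
  lines⇒segments colourLines S =
    pullback OnSeg OnLine (proj₁ S) lines canonical
      InP-canonical (λ i _ → OnSeg⇒OnLine-canonical i) (colourLines lineSet)
    where open SupportLines ℝ S

  segments⇒lines : EFLSegments m → EFLLines m
  segments⇒lines colourSegments L =
    pullback OnLine OnSeg (proj₁ L) segment (λ i → i) InP-enclosed OnLine-enclosed (colourSegments segmentSet)
    where open EnclosingSegments ℝ L
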